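{- Let $\sigma,\omega\in S_\infty$ with $\sigma<_{\mathrm{Bruhat}}\omega$. Then the poset $([\sigma,\omega]^f,<_{\mathrm{Bruhat}})$ is interval-finite.
   Context: $S_\infty$ is the group of bijections $\mathbb N\to\mathbb N$, with the Bruhat order: $\sigma\le_{\mathrm{Bruhat}}\omega$ iff for every $n$, the $i$-th smallest element of $\{\sigma(1),\dots,\sigma(n)\}$ is at most the $i$-th smallest of $\{\omega(1),\dots,\omega(n)\}$ for all $i$. $\nu\approx\sigma$ means $\nu(n)\ne\sigma(n)$ for only finitely many $n$. $[\sigma,\omega]^f=\{\nu:\sigma\le_{\mathrm{Bruhat}}\nu\le_{\mathrm{Bruhat}}\omega,\ \nu\approx\sigma\}$. A poset is interval-finite if every interval $[p,p']=\{q:p\le q\le p'\}$ is finite. -}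

module Defs where

open import Data.Nat using (ℕ; _≤_; _≥_)
open import Data.Nat.Properties using (≤-decTotalOrder)
open import Data.List using (List; map; upTo)
open import Data.List.Relation.Binary.Pointwise using (Pointwise)
open import Data.List.Membership.Propositional using (_∈_)
open import Data.Product using (Σ; ∃; ∃-syntax; _×_)
open import Function.Bundles using (Bijection; _⤖_)
open import Relation.Binary.PropositionalEquality using (_≡_)
open import Relation.Nullary using (¬_)
open import Data.List.Sort.InsertionSort.Base ≤-decTotalOrder using (sort)

-- S∞ : bijections ℕ → ℕ  (ℕ here starts at 0; shift of the paper's ℕ = {1,2,...})
S∞ : Set
S∞ = ℕ ⤖ ℕ

app : S∞ → ℕ → ℕ
app σ = Bijection.to σ

prefixSorted : S∞ → ℕ → List ℕ
prefixSorted σ n = sort (map (app σ) (upTo n))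

_≤B_ : S∞ → S∞ → Set
σ ≤B ω = ∀ n → Pointwise _≤_ (prefixSorted σ n) (prefixSorted ω n)

_≐_ : S∞ → S∞ → Set
σ ≐ ω = ∀ n → app σ n ≡ app ω n

_<B_ : S∞ → S∞ → Set
σ <B ω = σ ≤B ω × ¬ (σ ≐ ω)

_≈f_ : S∞ → S∞ → Set
ν ≈f σ = ∃[ N ] (∀ n → n ≥ N → app ν n ≡ app σ n)

Interval-f : S∞ → S∞ → S∞ → Set
Interval-f σ ω ν = σ ≤B ν × ν ≤B ω × ν ≈f σ

FiniteSet : (S∞ → Set) → Set
FiniteSet P = Σ (List S∞) (λ L → ∀ q → P q → ∃[ r ] (r ∈ L × q ≐ r))

IntervalFinite : (S∞ → Set) → Set
IntervalFinite P = ∀ p p' → P p → P p' →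
  FiniteSet (λ q → P q × p ≤B q × q ≤B p')

module Submission where

-- If p and p' agree from N on, then their first n values form the same set for every n ≥ N,
-- so the Bruhat conditions p ≤ q ≤ p' pin down the sorted prefixes of q at every n ≥ N.
-- Equal value sets at n and n + 1 force q(n) = p(n); hence q agrees with p from N on and
-- merely rearranges p(0), …, p(N-1), which leaves finitely many candidates.

open import Defs
open import Data.Nat using (ℕ; zero; suc; _≤_; _<_; _≥_; z≤n; s≤s; _⊔_)
open import Data.Nat.Properties
open import Data.List using (List; []; _∷_; map; upTo; applyUpTo; length; cartesianProductWith)
open import Data.List.Properties using (length-map; length-upTo)
open import Data.List.Relation.Binary.Pointwise using (Pointwise; Pointwise-≡⇒≡)
open import Data.List.Relation.Binary.Pointwise.Properties using (antisymmetric)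
open import Data.List.Membership.Propositional using (_∈_)
open import Data.List.Membership.Propositional.Properties
  using (∈-map⁺; ∈-map⁻; ∈-upTo⁺; ∈-upTo⁻; ∈-cartesianProductWith⁺)
open import Data.List.Membership.Propositional.Properties.WithK using (unique∧set⇒bag)
open import Data.List.Membership.DecPropositional _≟_ using (_∈?_)
open import Data.List.Relation.Binary.BagAndSetEquality using (∼bag⇒↭)
open import Data.List.Relation.Binary.Permutation.Propositional
  using (_↭_; ↭-sym; ↭-trans; ↭⇒↭ₛ)
open import Data.List.Relation.Binary.Permutation.Propositional.Properties using (∈-resp-↭)
open import Data.List.Relation.Unary.All as All using (All; []; _∷_)
open import Data.List.Relation.Unary.AllPairs using (_∷_)
open import Data.List.Relation.Unary.Any using (here; there)
open import Data.List.Relation.Unary.Unique.Propositional using (Unique)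
import Data.List.Relation.Unary.Unique.Propositional.Properties as Unique
open import Data.List.Relation.Unary.Unique.DecPropositional _≟_ using (unique?)
open import Data.List.Relation.Unary.Sorted.TotalOrder.Properties using (↗↭↗⇒≋)
open import Data.List.Sort.InsertionSort.Base ≤-decTotalOrder using (sort)
open import Data.List.Sort.InsertionSort.Properties ≤-decTotalOrder using (sort-↭; sort-↗)
open import Data.Empty using (⊥-elim)
open import Data.Product using (∃-syntax; _×_; _,_; proj₁; proj₂)
open import Data.Sum using (inj₁; inj₂)
open import Function.Bundles using (Bijection; mk⇔)
open import Relation.Binary.PropositionalEquality
open import Relation.Nullary using (¬_; Dec; yes; no; _×-dec_)

sort-↭⇒≡ : ∀ {xs ys : List ℕ} → xs ↭ ys → sort xs ≡ sort ys
sort-↭⇒≡ {xs} {ys} xs↭ys = Pointwise-≡⇒≡ (↗↭↗⇒≋ ≤-totalOrder (sort-↗ xs) (sort-↗ ys)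
  (↭⇒↭ₛ (↭-trans (sort-↭ xs) (↭-trans xs↭ys (↭-sym (sort-↭ ys))))))

Pointwise-≤-squeeze : ∀ {xs ys zs} → Pointwise _≤_ xs ys → Pointwise _≤_ ys zs → xs ≡ zs → ys ≡ xs
Pointwise-≤-squeeze xs≤ys ys≤zs refl = Pointwise-≡⇒≡ (antisymmetric ≤-antisym ys≤zs xs≤ys)

module _ {A : Set} where

  lookupOr : List A → ℕ → A → A
  lookupOr []       i       d = d
  lookupOr (x ∷ xs) zero    d = x
  lookupOr (x ∷ xs) (suc i) d = lookupOr xs i d

  lookupOr-≥ : ∀ xs {i} d → length xs ≤ i → lookupOr xs i d ≡ d
  lookupOr-≥ []       d _           = refl
  lookupOr-≥ (x ∷ xs) d (s≤s len≤i) = lookupOr-≥ xs d len≤i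

  lookupOr-∈ : ∀ xs {i} d → i < length xs → lookupOr xs i d ∈ xs
  lookupOr-∈ (x ∷ xs) {zero}  d _         = here refl
  lookupOr-∈ (x ∷ xs) {suc i} d (s≤s i<n) = there (lookupOr-∈ xs d i<n)

  ∈⇒lookupOr : ∀ xs {x} → x ∈ xs → ∃[ i ] (i < length xs × ∀ d → lookupOr xs i d ≡ x)
  ∈⇒lookupOr (y ∷ xs) (here refl) = zero , s≤s z≤n , λ _ → refl
  ∈⇒lookupOr (y ∷ xs) (there x∈xs) with ∈⇒lookupOr xs x∈xs
  ... | i , i<n , xs[i]≡x = suc i , s≤s i<n , xs[i]≡x

  lookupOr-injective : ∀ {xs} → Unique xs → ∀ {i j} d e → i < length xs → j < length xs →
    lookupOr xs i d ≡ lookupOr xs j e → i ≡ j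
  lookupOr-injective {x ∷ xs} _ {zero} {zero} d e _ _ _ = refl
  lookupOr-injective {x ∷ xs} (x∉xs ∷ _) {zero} {suc j} d e _ (s≤s j<n) x≡ =
    ⊥-elim (All.lookup x∉xs (lookupOr-∈ xs e j<n) x≡)
  lookupOr-injective {x ∷ xs} (x∉xs ∷ _) {suc i} {zero} d e (s≤s i<n) _ ≡x =
    ⊥-elim (All.lookup x∉xs (lookupOr-∈ xs d i<n) (sym ≡x))
  lookupOr-injective {x ∷ xs} (_ ∷ xs!) {suc i} {suc j} d e (s≤s i<n) (s≤s j<n) eq =
    cong suc (lookupOr-injective xs! d e i<n j<n eq)

  lookupOr-map-applyUpTo : ∀ {B : Set} (f : B → A) (g : ℕ → B) {n i} d → i < n →
    lookupOr (map f (applyUpTo g n)) i d ≡ f (g i)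
  lookupOr-map-applyUpTo f g {suc n} {zero}  d _         = refl
  lookupOr-map-applyUpTo f g {suc n} {suc i} d (s≤s i<n) = lookupOr-map-applyUpTo f (λ k → g (suc k)) d i<n

  listsOfLength : List A → ℕ → List (List A)
  listsOfLength xs zero    = [] ∷ []
  listsOfLength xs (suc k) = cartesianProductWith _∷_ xs (listsOfLength xs k)

  ∈-listsOfLength : ∀ xs {ys} → All (_∈ xs) ys → ys ∈ listsOfLength xs (length ys)
  ∈-listsOfLength xs []          = here refl
  ∈-listsOfLength xs (y∈ ∷ ys⊆) = ∈-cartesianProductWith⁺ _∷_ y∈ (∈-listsOfLength xs ys⊆)

app-injective : ∀ (σ : S∞) {i j} → app σ i ≡ app σ j → i ≡ j
app-injective σ = Bijection.injective σ

prefixValues : S∞ → ℕ → List ℕ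
prefixValues σ n = map (app σ) (upTo n)

∈-prefixValues⁺ : ∀ σ {n i} → i < n → app σ i ∈ prefixValues σ n
∈-prefixValues⁺ σ i<n = ∈-map⁺ (app σ) (∈-upTo⁺ i<n)

∈-prefixValues⁻ : ∀ σ {n x} → x ∈ prefixValues σ n → ∃[ i ] (i < n × app σ i ≡ x)
∈-prefixValues⁻ σ x∈ with ∈-map⁻ (app σ) x∈
... | i , i∈ , x≡σi = i , ∈-upTo⁻ i∈ , sym x≡σi

prefixValues-unique : ∀ σ n → Unique (prefixValues σ n)
prefixValues-unique σ n = Unique.map⁺ (app-injective σ) (Unique.upTo⁺ n)

length-prefixValues : ∀ σ n → length (prefixValues σ n) ≡ n
length-prefixValues σ n = trans (length-map (app σ) (upTo n)) (length-upTo n)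

lookupOr-prefixValues : ∀ σ {n i} d → i < n → lookupOr (prefixValues σ n) i d ≡ app σ i
lookupOr-prefixValues σ d = lookupOr-map-applyUpTo (app σ) (λ k → k) d

prefixSorted-≡⇒⊆ : ∀ a b {n x} → prefixSorted a n ≡ prefixSorted b n →
  x ∈ prefixValues a n → x ∈ prefixValues b n
prefixSorted-≡⇒⊆ a b {n} eq x∈ =
  ∈-resp-↭ (sort-↭ (prefixValues b n)) (subst (_ ∈_) eq (∈-resp-↭ (↭-sym (sort-↭ (prefixValues a n))) x∈))

EqualFrom : ℕ → S∞ → S∞ → Set
EqualFrom N a b = ∀ m → m ≥ N → app a m ≡ app b m

EqualFrom-sym : ∀ a b {N} → EqualFrom N a b → EqualFrom N b a
EqualFrom-sym _ _ a≡b m m≥N = sym (a≡b m m≥N)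

EqualFrom-trans : ∀ a b c {N} → EqualFrom N a b → EqualFrom N b c → EqualFrom N a c
EqualFrom-trans _ _ _ a≡b b≡c m m≥N = trans (a≡b m m≥N) (b≡c m m≥N)

EqualFrom-mono : ∀ a b {M N} → M ≤ N → EqualFrom M a b → EqualFrom N a b
EqualFrom-mono _ _ M≤N a≡b m m≥N = a≡b m (≤-trans M≤N m≥N)

prefixValues-⊆ : ∀ a b {N} → EqualFrom N a b → ∀ {n} → n ≥ N → ∀ {x} →
  x ∈ prefixValues a n → x ∈ prefixValues b n
prefixValues-⊆ a b a≡b {n} n≥N x∈ with ∈-prefixValues⁻ a x∈
... | i , i<n , refl with Bijection.strictlySurjective b (app a i)
... | j , bj≡ai with j <? n
... | yes j<n = subst (_∈ prefixValues b n) bj≡ai (∈-prefixValues⁺ b j<n)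
... | no j≮n = ⊥-elim (<-irrefl i≡j (<-≤-trans i<n (≮⇒≥ j≮n)))
  where
  i≡j : i ≡ j
  i≡j = app-injective a (trans (sym bj≡ai) (sym (a≡b j (≤-trans n≥N (≮⇒≥ j≮n)))))

prefixValues-↭ : ∀ a b {N} → EqualFrom N a b → ∀ {n} → n ≥ N → prefixValues a n ↭ prefixValues b n
prefixValues-↭ a b a≡b {n} n≥N =
  ∼bag⇒↭ (unique∧set⇒bag (prefixValues-unique a n) (prefixValues-unique b n)
    (mk⇔ (prefixValues-⊆ a b a≡b n≥N) (prefixValues-⊆ b a (EqualFrom-sym a b a≡b) n≥N)))

prefixSorted-≡⇒EqualFrom : ∀ p q {N} → (∀ m → m ≥ N → prefixSorted q m ≡ prefixSorted p m) →
  EqualFrom N q p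
prefixSorted-≡⇒EqualFrom p q {N} eqs n n≥N
  with ∈-prefixValues⁻ p (prefixSorted-≡⇒⊆ q p (eqs (suc n) (m≤n⇒m≤1+n n≥N)) (∈-prefixValues⁺ q ≤-refl))
... | j , j<1+n , pj≡qn with m<1+n⇒m<n∨m≡n j<1+n
... | inj₂ refl = sym pj≡qn
... | inj₁ j<n with ∈-prefixValues⁻ q (prefixSorted-≡⇒⊆ p q (sym (eqs n n≥N)) (∈-prefixValues⁺ p j<n))
... | k , k<n , qk≡pj = ⊥-elim (<-irrefl (app-injective q (trans qk≡pj pj≡qn)) k<n)

≤B-between-EqualFrom : ∀ p q p' {N} → EqualFrom N p p' → p ≤B q → q ≤B p' →
  EqualFrom N q p × prefixSorted q N ≡ prefixSorted p N
≤B-between-EqualFrom p q p' {N} p≡p' p≤q q≤p' =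
  prefixSorted-≡⇒EqualFrom p q sorted≡ , sorted≡ N ≤-refl
  where
  sorted≡ : ∀ m → m ≥ N → prefixSorted q m ≡ prefixSorted p m
  sorted≡ m m≥N = Pointwise-≤-squeeze (p≤q m) (q≤p' m) (sort-↭⇒≡ (prefixValues-↭ p p' p≡p' m≥N))

module Rearrangement (p : S∞) (N : ℕ) where

  values : List ℕ
  values = prefixValues p N

  IsRearrangement : List ℕ → Set
  IsRearrangement vs = All (_∈ values) vs × All (_∈ vs) values × Unique vs × length vs ≡ N

  isRearrangement? : ∀ vs → Dec (IsRearrangement vs)
  isRearrangement? vs =
    All.all? (_∈? values) vs ×-dec All.all? (_∈? vs) values ×-dec unique? vs ×-dec (length vs ≟ N)

  patched : List ℕ → ℕ → ℕ
  patched vs i = lookupOr vs i (app p i)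

  module _ {vs : List ℕ} (r : IsRearrangement vs) where
    private
      vs⊆values : All (_∈ values) vs
      vs⊆values = proj₁ r
      values⊆vs : All (_∈ vs) values
      values⊆vs = proj₁ (proj₂ r)
      vs-unique : Unique vs
      vs-unique = proj₁ (proj₂ (proj₂ r))
      length-vs : length vs ≡ N
      length-vs = proj₂ (proj₂ (proj₂ r))

    patched-disjoint : ∀ {i j} → i < length vs → ¬ (j < length vs) → patched vs i ≢ patched vs j
    patched-disjoint {i} {j} i<n j≮n eq with ∈-prefixValues⁻ p (All.lookup vs⊆values (lookupOr-∈ vs (app p i) i<n))
    ... | k , k<N , pk≡ = j≮n (subst (_< length vs) k≡j (subst (k <_) (sym length-vs) k<N))
      where
      k≡j : k ≡ j
      k≡j = app-injective p (trans pk≡ (trans eq (lookupOr-≥ vs (app p j) (≮⇒≥ j≮n))))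

    patched-injective : ∀ {i j} → patched vs i ≡ patched vs j → i ≡ j
    patched-injective {i} {j} eq with i <? length vs | j <? length vs
    ... | yes i<n | yes j<n = lookupOr-injective vs-unique (app p i) (app p j) i<n j<n eq
    ... | yes i<n | no j≮n  = ⊥-elim (patched-disjoint i<n j≮n eq)
    ... | no i≮n  | yes j<n = ⊥-elim (patched-disjoint j<n i≮n (sym eq))
    ... | no i≮n  | no j≮n  = app-injective p
      (trans (sym (lookupOr-≥ vs (app p i) (≮⇒≥ i≮n))) (trans eq (lookupOr-≥ vs (app p j) (≮⇒≥ j≮n))))

    patched-surjective : ∀ y → ∃[ i ] patched vs i ≡ y
    patched-surjective y with Bijection.strictlySurjective p y
    ... | j , pj≡y with j <? length vs
    ... | no j≮n = j , trans (lookupOr-≥ vs (app p j) (≮⇒≥ j≮n)) pj≡y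
    ... | yes j<n with ∈⇒lookupOr vs (All.lookup values⊆vs (∈-prefixValues⁺ p (subst (j <_) length-vs j<n)))
    ... | i , _ , vs[i]≡pj = i , trans (vs[i]≡pj (app p i)) pj≡y

    patch : S∞
    patch = record
      { to        = patched vs
      ; cong      = cong (patched vs)
      ; bijective = patched-injective , λ y → let i , eq = patched-surjective y in i , λ { refl → eq }
      }

  patchIfRearrangement : ∀ vs → Dec (IsRearrangement vs) → S∞
  patchIfRearrangement vs (yes r) = patch r
  patchIfRearrangement vs (no _)  = p   -- junk candidate, never the witness for any q

  patch-≐ : ∀ {vs} (r : IsRearrangement vs) d → patch r ≐ patchIfRearrangement vs d
  patch-≐ r (yes _) _ = refl
  patch-≐ r (no ¬r) _ = ⊥-elim (¬r r)

  candidates : List S∞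
  candidates = map (λ vs → patchIfRearrangement vs (isRearrangement? vs)) (listsOfLength values N)

  candidates-complete : ∀ q → EqualFrom N q p → prefixSorted q N ≡ prefixSorted p N →
    ∃[ s ] (s ∈ candidates × q ≐ s)
  candidates-complete q q≡p sorted≡ =
    patchIfRearrangement vs (isRearrangement? vs) ,
    ∈-map⁺ _ (subst (λ k → vs ∈ listsOfLength values k) length-vs (∈-listsOfLength values vs⊆values)) ,
    λ n → trans (q≐patch n) (patch-≐ r (isRearrangement? vs) n)
    where
    vs : List ℕ
    vs = prefixValues q N
    length-vs : length vs ≡ N
    length-vs = length-prefixValues q N
    vs⊆values : All (_∈ values) vs
    vs⊆values = All.tabulate (prefixSorted-≡⇒⊆ q p sorted≡)
    r : IsRearrangement vs
    r = vs⊆values , All.tabulate (prefixSorted-≡⇒⊆ p q (sym sorted≡)) , prefixValues-unique q N , length-vs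
    q≐patch : q ≐ patch r
    q≐patch n with n <? N
    ... | yes n<N = sym (lookupOr-prefixValues q (app p n) n<N)
    ... | no n≮N  = trans (q≡p n (≮⇒≥ n≮N))
      (sym (lookupOr-≥ vs (app p n) (subst (_≤ n) (sym length-vs) (≮⇒≥ n≮N))))

≤B-interval-finite : ∀ p p' {N} → EqualFrom N p p' → FiniteSet (λ q → p ≤B q × q ≤B p')
≤B-interval-finite p p' {N} p≡p' = candidates , λ q (p≤q , q≤p') →
  let q≡p , sorted≡ = ≤B-between-EqualFrom p q p' p≡p' p≤q q≤p'
  in  candidates-complete q q≡p sorted≡
  where open Rearrangement p N

mainTheorem17 : ∀ (σ ω : S∞) → σ <B ω → IntervalFinite (Interval-f σ ω)
mainTheorem17 σ ω _ p p' (_ , _ , N₁ , p≡σ) (_ , _ , N₂ , p'≡σ) =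
  let L , complete = ≤B-interval-finite p p' p≡p'
  in  L , λ q (_ , p≤q , q≤p') → complete q (p≤q , q≤p')
  where
  p≡p' : EqualFrom (N₁ ⊔ N₂) p p'
  p≡p' = EqualFrom-trans p σ p' (EqualFrom-mono p σ (m≤m⊔n N₁ N₂) p≡σ)
           (EqualFrom-sym p' σ (EqualFrom-mono p' σ (m≤n⊔m N₁ N₂) p'≡σ))
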